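{- Fix an integer $N\ge 0$. Let $\mathscr{A}$ be the set of quintuples $(n;\alpha,\beta,\gamma,\lambda,\mu)$, where $n\ge 0$ is an integer and $\alpha,\beta,\gamma,\lambda,\mu$ are partitions, such that: $\alpha$ has distinct positive parts; $\beta$ has positive parts; $\gamma$ has distinct nonnegative parts; $\lambda$ has distinct nonnegative parts, each $\le n-1$; $\mu$ has nonnegative parts, each $\le n-1$; and $n-l(\gamma)=N$. Let $\mathscr{B}$ be the set of quintuples $(A,B,C,D,E)$ of partitions such that: $A$ and $C$ have distinct nonnegative parts; $B$ and $D$ have nonnegative parts; $E$ has distinct positive parts; and $l(C)+l(D)-l(E)=N$. Then there is a bijection $\mathscr{A}\to\mathscr{B}$, $(n;\alpha,\beta,\gamma,\lambda,\mu)\mapsto(A,B,C,D,E)$, such that $|\alpha|+|\beta|+|\gamma|+|\lambda|+|\mu|=|A|+|B|+|C|+|D|+|E|$, $l(\lambda)-l(\alpha)-l(\gamma)=l(C)-l(A)-l(E)$, and $l(\gamma)+l(\mu)=l(A)+l(B)$.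
   Context: A partition $\lambda=(\lambda_1,\dots,\lambda_r)$ is a finite sequence of integers with $\lambda_1\ge\cdots\ge\lambda_r\ge 0$; zero parts are allowed and are counted among the parts. Its length is $l(\lambda)=r$ and its weight is $|\lambda|=\sum_i\lambda_i$. A partition has distinct parts if its parts are strictly decreasing. (In the paper, the statistics $|\cdot|$, the $a$-exponent $l(\lambda)-l(\alpha)-l(\gamma)$ resp. $l(C)-l(A)-l(E)$, and the $b$-exponent $l(\gamma)+l(\mu)$ resp. $l(A)+l(B)$ are the statistics tracked by the generating functions of the two sides of the coefficient of $z^N$ in the identity $\frac{(-q/a;q)_\infty(-b/az;q)_\infty}{(q;q)_\infty}\sum_{n=-\infty}^{\infty}\frac{(-a;q)_n}{(b;q)_n}z^n=\frac{(-b/a;q)_\infty(-az;q)_\infty(-q/az;q)_\infty}{(b;q)_\infty(z;q)_\infty}$.) -}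

module Defs where

open import Data.Nat using (ℕ) renaming (_+_ to _+ℕ_)
open import Data.Nat using ( _≤_; _<_; _≥_; _>_)
open import Data.Integer using (ℤ; +_; _-_) renaming (_+_ to _+ℤ_)
open import Data.List using (List; []; _∷_; length)
open import Data.Nat.ListAction using (sum)
open import Data.List.Relation.Unary.All using (All)
open import Data.Product using (Σ; _×_; _,_)
open import Relation.Binary.PropositionalEquality using (_≡_)

-- A partition: a finite list of naturals λ₁ ≥ λ₂ ≥ ... ≥ λᵣ ≥ 0
-- (zero parts allowed and counted in the length).
data Decreasing : List ℕ → Set where
  []  : Decreasing []
  [-] : ∀ x → Decreasing (x ∷ [])
  _∷_ : ∀ {x y ys} → x ≥ y → Decreasing (y ∷ ys) → Decreasing (x ∷ y ∷ ys)

data StrictDecreasing : List ℕ → Set where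
  []  : StrictDecreasing []
  [-] : ∀ x → StrictDecreasing (x ∷ [])
  _∷_ : ∀ {x y ys} → x > y → StrictDecreasing (y ∷ ys) → StrictDecreasing (x ∷ y ∷ ys)

len : List ℕ → ℕ
len = length

wt : List ℕ → ℕ
wt = sum

Positive : List ℕ → Set
Positive = All (λ x → 0 < x)

Bounded : ℕ → List ℕ → Set
Bounded n = All (λ x → x < n)

ℓ : List ℕ → ℤ
ℓ xs = + length xs

record SetA (N : ℕ) : Set where
  constructor mkA
  field
    n : ℕ
    α β γ λ' μ : List ℕ
    α-dist : StrictDecreasing α
    α-pos  : Positive α
    β-part : Decreasing β
    β-pos  : Positive β
    γ-dist : StrictDecreasing γ
    λ-dist : StrictDecreasing λ'
    λ-bd   : Bounded n λ'
    μ-part : Decreasing μ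
    μ-bd   : Bounded n μ
    cond   : (+ n) - ℓ γ ≡ + N

record SetB (N : ℕ) : Set where
  constructor mkB
  field
    A B C D E : List ℕ
    A-dist : StrictDecreasing A
    B-part : Decreasing B
    C-dist : StrictDecreasing C
    D-part : Decreasing D
    E-dist : StrictDecreasing E
    E-pos  : Positive E
    cond   : (ℓ C +ℤ ℓ D) - ℓ E ≡ + N

weightA : ∀ {N} → SetA N → ℕ
weightA a = wt α +ℕ wt β +ℕ wt γ +ℕ wt λ' +ℕ wt μ
  where open SetA a

weightB : ∀ {N} → SetB N → ℕ
weightB b = wt A +ℕ wt B +ℕ wt C +ℕ wt D +ℕ wt E
  where open SetB b

aExpA : ∀ {N} → SetA N → ℤ
aExpA a = (ℓ λ' - ℓ α) - ℓ γ where open SetA a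

aExpB : ∀ {N} → SetB N → ℤ
aExpB b = (ℓ C - ℓ A) - ℓ E where open SetB b

bExpA : ∀ {N} → SetA N → ℕ
bExpA a = len γ +ℕ len μ where open SetA a

bExpB : ∀ {N} → SetB N → ℕ
bExpB b = len A +ℕ len B where open SetB b

-- Cut (α, β, γ, λ, μ) into the pair (α, β), the set λ ∩ [0, N) and the configuration of level N
-- formed by γ, λ ∩ [N, n) and μ; recall n = l(γ) + N. In general a configuration of level M is a
-- distinct partition γ, a set S ⊆ [M, M + l(γ)) and a partition with parts below M + l(γ).
-- Raising the level by one is a bijection: the value M leaves the window and, if it lay in S, is
-- traded for the new value M + l(γ), paid for by lowering the parts of γ by one. Once the level
-- exceeds the weight, S is empty, so configurations of any level correspond to pairs of a
-- distinct partition and a partition; this bijection Φ preserves the weight, #S − l(γ) and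
-- l(γ) + l(μ). Now Φ sends the configuration to (A, B), while Φ⁻¹ sends (α, β) to a configuration
-- (γ′, S′, μ′). Then E is γ′ raised by one, and the set S′ ∪ (λ ∩ [0, N)) ⊆ [0, l(E) + N) together
-- with the partition μ′ + 1 amounts to (C, D) with l(C) + l(D) = l(E) + N, built one top value at
-- a time, each step raising all parts of C and D and adding one new least part.

module Submission where

open import Defs
open import Data.Nat using (ℕ; zero; suc; pred; _+_; _*_; _∸_; _≤_; _<_; z≤n; s≤s; s≤s⁻¹; _≟_; _≤?_)
open import Data.Nat.Properties
open import Data.Nat.ListAction using (sum)
open import Data.List using (List; []; _∷_; length; reverse; _∷ʳ_; _++_; map)
open import Data.List.Properties using (unfold-reverse; reverse-involutive; length-reverse; length-++; map-∘; map-id; map-id-local)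
open import Data.List.Relation.Unary.All as All using (All; []; _∷_)
import Data.List.Relation.Unary.All.Properties as All
open import Data.List.Relation.Binary.Permutation.Propositional.Properties using (All-resp-↭; ↭-reverse)
open import Data.List.Relation.Binary.Permutation.Propositional using (↭-sym)
open import Data.Nat.ListAction.Properties using (sum-↭; sum-++)
open import Data.Bool using (Bool; true; false; if_then_else_)
open import Data.Vec using (Vec; []; _∷_; replicate; init; last; initLast; take; drop) renaming (_++_ to _++ᵛ_; _∷ʳ_ to _∷ʳᵛ_)
open import Data.Vec.Properties using (init-∷ʳ; last-∷ʳ; take++drop≡id; ++-injectiveˡ; ++-injectiveʳ)
open import Function using (_∘_)
open import Function.Bundles using (_↔_; Inverse; mk↔ₛ′)
open import Function.Construct.Identity using (↔-id)
open import Function.Construct.Composition using (_↔-∘_)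
open import Function.Construct.Symmetry using (↔-sym)
open import Data.Unit using (⊤; tt)
open import Data.Product using (Σ; _×_; _,_; proj₁; proj₂; uncurry; map₂)
open import Relation.Unary using (Irrelevant)
open import Axiom.UniquenessOfIdentityProofs using (module Decidable⇒UIP)
open import Relation.Nullary using (yes; no; contradiction)
open import Relation.Binary.PropositionalEquality
open import Data.Nat.Tactic.RingSolver using (solve-∀)
open import Data.Integer using (ℤ; +_; -_; _-_) renaming (_+_ to _ℤ+_)
import Data.Integer.Properties as ℤ
open import Data.Integer.Tactic.RingSolver using () renaming (solve-∀ to ℤ-solve-∀)

second↔ : ∀ {C A B : Set} → A ↔ B → (C × A) ↔ (C × B)
second↔ f = mk↔ₛ′ (map₂ (Inverse.to f)) (map₂ (Inverse.from f))
                  (λ (c , b) → cong (c ,_) (Inverse.strictlyInverseˡ f b))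
                  (λ (c , a) → cong (c ,_) (Inverse.strictlyInverseʳ f a))

Σ-second↔ : ∀ {I : Set} {A B : I → Set} → (∀ i → A i ↔ B i) → Σ I A ↔ Σ I B
Σ-second↔ f = mk↔ₛ′ (λ (i , a) → i , Inverse.to (f i) a) (λ (i , b) → i , Inverse.from (f i) b)
                    (λ (i , b) → cong (i ,_) (Inverse.strictlyInverseˡ (f i) b))
                    (λ (i , a) → cong (i ,_) (Inverse.strictlyInverseʳ (f i) a))

data Descending (δ : ℕ) : List ℕ → Set where
  []  : Descending δ []
  [-] : ∀ x → Descending δ (x ∷ [])
  _∷_ : ∀ {x y ys} → δ + y ≤ x → Descending δ (y ∷ ys) → Descending δ (x ∷ y ∷ ys)

Descending⇒Decreasing : ∀ {xs} → Descending 0 xs → Decreasing xs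
Descending⇒Decreasing []        = []
Descending⇒Decreasing ([-] x)   = [-] x
Descending⇒Decreasing (p ∷ ps)  = p ∷ Descending⇒Decreasing ps

Decreasing⇒Descending : ∀ {xs} → Decreasing xs → Descending 0 xs
Decreasing⇒Descending []        = []
Decreasing⇒Descending ([-] x)   = [-] x
Decreasing⇒Descending (p ∷ ps)  = p ∷ Decreasing⇒Descending ps

Descending⇒StrictDecreasing : ∀ {xs} → Descending 1 xs → StrictDecreasing xs
Descending⇒StrictDecreasing []        = []
Descending⇒StrictDecreasing ([-] x)   = [-] x
Descending⇒StrictDecreasing (p ∷ ps)  = p ∷ Descending⇒StrictDecreasing ps

StrictDecreasing⇒Descending : ∀ {xs} → StrictDecreasing xs → Descending 1 xs
StrictDecreasing⇒Descending []        = []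
StrictDecreasing⇒Descending ([-] x)   = [-] x
StrictDecreasing⇒Descending (p ∷ ps)  = p ∷ StrictDecreasing⇒Descending ps

Descending-irrelevant : ∀ {δ} → Irrelevant (Descending δ)
Descending-irrelevant []       []       = refl
Descending-irrelevant ([-] x)  ([-] x)  = refl
Descending-irrelevant (p ∷ ps) (q ∷ qs) = cong₂ _∷_ (≤-irrelevant p q) (Descending-irrelevant ps qs)

Decreasing-irrelevant : Irrelevant Decreasing
Decreasing-irrelevant []       []       = refl
Decreasing-irrelevant ([-] x)  ([-] x)  = refl
Decreasing-irrelevant (p ∷ ps) (q ∷ qs) = cong₂ _∷_ (≤-irrelevant p q) (Decreasing-irrelevant ps qs)

StrictDecreasing-irrelevant : Irrelevant StrictDecreasing
StrictDecreasing-irrelevant []       []       = refl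
StrictDecreasing-irrelevant ([-] x)  ([-] x)  = refl
StrictDecreasing-irrelevant (p ∷ ps) (q ∷ qs) = cong₂ _∷_ (<-irrelevant p q) (StrictDecreasing-irrelevant ps qs)

Descending-tail : ∀ {δ x xs} → Descending δ (x ∷ xs) → Descending δ xs
Descending-tail ([-] _) = []
Descending-tail (_ ∷ ps) = ps

Descending-head : ∀ {δ x xs} → Descending δ (x ∷ xs) → All (λ y → δ + y ≤ x) xs
Descending-head ([-] _) = []
Descending-head {δ} (p ∷ ps) =
  p ∷ All.map (λ q → ≤-trans q (≤-trans (m≤n+m _ δ) p)) (Descending-head ps)

Descending-∷ : ∀ {δ x xs} → All (λ y → δ + y ≤ x) xs → Descending δ xs → Descending δ (x ∷ xs)
Descending-∷ _        []       = [-] _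
Descending-∷ (p ∷ _)  ([-] _)  = p ∷ [-] _
Descending-∷ (p ∷ _)  (q ∷ qs) = p ∷ q ∷ qs

Descending-∷ʳ : ∀ {δ y xs} → Descending δ xs → All (λ x → δ + y ≤ x) xs → Descending δ (xs ∷ʳ y)
Descending-∷ʳ []              []           = [-] _
Descending-∷ʳ ([-] x)         (p ∷ [])     = p ∷ [-] _
Descending-∷ʳ (p ∷ ps)        (_ ∷ qs)     = p ∷ Descending-∷ʳ ps qs

Descending-map : ∀ {f : ℕ → ℕ} → (∀ {x y} → x ≤ y → f x ≤ f y) → ∀ {xs} → Descending 0 xs → Descending 0 (map f xs)
Descending-map mono []       = []
Descending-map mono ([-] x)  = [-] _
Descending-map mono (p ∷ ps) = mono p ∷ Descending-map mono ps

All-reverse : ∀ {P : ℕ → Set} {xs} → All P xs → All P (reverse xs)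
All-reverse {xs = xs} = All-resp-↭ (↭-sym (↭-reverse xs))

sum-reverse : ∀ xs → sum (reverse xs) ≡ sum xs
sum-reverse xs = sum-↭ (↭-reverse xs)

sum-map-suc : ∀ xs → sum (map suc xs) ≡ length xs + sum xs
sum-map-suc []       = refl
sum-map-suc (x ∷ xs) = trans (cong (λ t → suc x + t) (sum-map-suc xs)) (solve x (length xs) (sum xs))
  where
  solve : ∀ x l s → suc x + (l + s) ≡ suc l + (x + s)
  solve = solve-∀

≤-sum : ∀ xs → All (_≤ sum xs) xs
≤-sum []       = []
≤-sum (x ∷ xs) = m≤m+n x (sum xs) ∷ All.map (λ y≤ → ≤-trans y≤ (m≤n+m (sum xs) x)) (≤-sum xs)

-- Gap encodings

AscendingFrom : ℕ → ℕ → List ℕ → Set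
AscendingFrom δ s []       = ⊤
AscendingFrom δ s (x ∷ xs) = s ≤ x × AscendingFrom δ (δ + x) xs

ascend : ℕ → ℕ → List ℕ → List ℕ
ascend δ s []       = []
ascend δ s (d ∷ ds) = s + d ∷ ascend δ (δ + (s + d)) ds

gapsFrom : ℕ → ℕ → List ℕ → List ℕ
gapsFrom δ s []       = []
gapsFrom δ s (x ∷ xs) = x ∸ s ∷ gapsFrom δ (δ + x) xs

ascend-ascending : ∀ δ s ds → AscendingFrom δ s (ascend δ s ds)
ascend-ascending δ s []       = tt
ascend-ascending δ s (d ∷ ds) = m≤m+n s d , ascend-ascending δ _ ds

gapsFrom-ascend : ∀ δ s ds → gapsFrom δ s (ascend δ s ds) ≡ ds
gapsFrom-ascend δ s []       = refl
gapsFrom-ascend δ s (d ∷ ds) = cong₂ _∷_ (m+n∸m≡n s d) (gapsFrom-ascend δ _ ds)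

ascend-gapsFrom : ∀ δ s xs → AscendingFrom δ s xs → ascend δ s (gapsFrom δ s xs) ≡ xs
ascend-gapsFrom δ s []       _       = refl
ascend-gapsFrom δ s (x ∷ xs) (p , q) rewrite m+[n∸m]≡n p = cong (x ∷_) (ascend-gapsFrom δ _ xs q)

length-ascend : ∀ δ s ds → length (ascend δ s ds) ≡ length ds
length-ascend δ s []       = refl
length-ascend δ s (d ∷ ds) = cong suc (length-ascend δ _ ds)

length-gapsFrom : ∀ δ s xs → length (gapsFrom δ s xs) ≡ length xs
length-gapsFrom δ s []       = refl
length-gapsFrom δ s (x ∷ xs) = cong suc (length-gapsFrom δ _ xs)

sum-ascend-+ : ∀ δ m s ds → sum (ascend δ (m + s) ds) ≡ m * length ds + sum (ascend δ s ds)
sum-ascend-+ δ m s []       = sym (trans (+-identityʳ (m * 0)) (*-zeroʳ m))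
sum-ascend-+ δ m s (d ∷ ds) = begin
  m + s + d + sum (ascend δ (δ + (m + s + d)) ds)
    ≡⟨ cong (λ t → m + s + d + sum (ascend δ t ds)) (reassociate δ m s d) ⟩
  m + s + d + sum (ascend δ (m + (δ + (s + d))) ds)
    ≡⟨ cong (λ t → m + s + d + t) (sum-ascend-+ δ m _ ds) ⟩
  m + s + d + (m * length ds + sum (ascend δ (δ + (s + d)) ds))
    ≡⟨ regroup m s d (length ds) (sum (ascend δ (δ + (s + d)) ds)) ⟩
  m * suc (length ds) + (s + d + sum (ascend δ (δ + (s + d)) ds)) ∎
  where
  open ≡-Reasoning
  reassociate : ∀ δ m s d → δ + (m + s + d) ≡ m + (δ + (s + d))
  reassociate = solve-∀
  regroup : ∀ m s d l r → m + s + d + (m * l + r) ≡ m * suc l + (s + d + r)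
  regroup = solve-∀

ascend-head-+ : ∀ δ m s d ds → ascend δ s (m + d ∷ ds) ≡ ascend δ (m + s) (d ∷ ds)
ascend-head-+ δ m s d ds = cong (λ t → t ∷ ascend δ (δ + t) ds) (solve m s d)
  where
  solve : ∀ m s d → s + (m + d) ≡ m + s + d
  solve = solve-∀

sum-ascend : ∀ δ s ds → sum (ascend δ s ds) ≡ s * length ds + sum (ascend δ 0 ds)
sum-ascend δ s ds = trans (cong (λ t → sum (ascend δ t ds)) (sym (+-identityʳ s))) (sum-ascend-+ δ s 0 ds)

AscendingFrom-≥ : ∀ {δ s} xs → AscendingFrom δ s xs → All (s ≤_) xs
AscendingFrom-≥ []       _       = []
AscendingFrom-≥ {δ} (x ∷ xs) (p , q) =
  p ∷ All.map (λ r → ≤-trans (≤-trans p (m≤n+m x δ)) r) (AscendingFrom-≥ xs q)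

AscendingFrom-∷ʳ : ∀ {δ s x} zs → AscendingFrom δ s zs → All (λ z → δ + z ≤ x) zs → s ≤ x →
                   AscendingFrom δ s (zs ∷ʳ x)
AscendingFrom-∷ʳ []       _       _        s≤x = s≤x , tt
AscendingFrom-∷ʳ (z ∷ zs) (p , q) (r ∷ rs) _   = p , AscendingFrom-∷ʳ zs q rs r

ascending-reverse : ∀ {δ s} xs → AscendingFrom δ s xs → Descending δ (reverse xs)
ascending-reverse []       _       = []
ascending-reverse (x ∷ xs) (_ , q) rewrite unfold-reverse x xs =
  Descending-∷ʳ (ascending-reverse xs q) (All-reverse (AscendingFrom-≥ xs q))

descending-reverse : ∀ {δ s} xs → Descending δ xs → All (s ≤_) xs → AscendingFrom δ s (reverse xs)
descending-reverse []       _  _          = tt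
descending-reverse (x ∷ xs) ps (s≤x ∷ qs) rewrite unfold-reverse x xs =
  AscendingFrom-∷ʳ (reverse xs) (descending-reverse xs (Descending-tail ps) qs)
                   (All-reverse (Descending-head ps)) s≤x

-- A list x₁ > ⋯ > xᵣ ≥ s (δ = 1), or x₁ ≥ ⋯ ≥ xᵣ ≥ s (δ = 0), is encoded by its gaps, smallest
-- part first: xᵣ − s, xᵣ₋₁ − xᵣ − δ, …, x₁ − x₂ − δ. Every list of naturals is a gap list.
fromGaps : ℕ → ℕ → List ℕ → List ℕ
fromGaps δ s ds = reverse (ascend δ s ds)

toGaps : ℕ → ℕ → List ℕ → List ℕ
toGaps δ s xs = gapsFrom δ s (reverse xs)

fromGaps-descending : ∀ δ s ds → Descending δ (fromGaps δ s ds)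
fromGaps-descending δ s ds = ascending-reverse (ascend δ s ds) (ascend-ascending δ s ds)

fromGaps-≥ : ∀ δ s ds → All (s ≤_) (fromGaps δ s ds)
fromGaps-≥ δ s ds = All-reverse (AscendingFrom-≥ (ascend δ s ds) (ascend-ascending δ s ds))

fromGaps-toGaps : ∀ {δ s xs} → Descending δ xs → All (s ≤_) xs → fromGaps δ s (toGaps δ s xs) ≡ xs
fromGaps-toGaps {δ} {s} {xs} ps qs = begin
  reverse (ascend δ s (gapsFrom δ s (reverse xs)))
    ≡⟨ cong reverse (ascend-gapsFrom δ s (reverse xs) (descending-reverse xs ps qs)) ⟩
  reverse (reverse xs)
    ≡⟨ reverse-involutive xs ⟩
  xs ∎
  where open ≡-Reasoning

toGaps-fromGaps : ∀ δ s ds → toGaps δ s (fromGaps δ s ds) ≡ ds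
toGaps-fromGaps δ s ds =
  trans (cong (gapsFrom δ s) (reverse-involutive (ascend δ s ds))) (gapsFrom-ascend δ s ds)

length-fromGaps : ∀ δ s ds → length (fromGaps δ s ds) ≡ length ds
length-fromGaps δ s ds = trans (length-reverse (ascend δ s ds)) (length-ascend δ s ds)

length-toGaps : ∀ δ s xs → length (toGaps δ s xs) ≡ length xs
length-toGaps δ s xs = trans (length-gapsFrom δ s (reverse xs)) (length-reverse xs)

sum-fromGaps : ∀ δ s ds → sum (fromGaps δ s ds) ≡ sum (ascend δ s ds)
sum-fromGaps δ s ds = sum-reverse (ascend δ s ds)

sum-fromGaps-1-1 : ∀ ds → sum (fromGaps 1 1 ds) ≡ length ds + sum (ascend 1 0 ds)
sum-fromGaps-1-1 ds =
  trans (sum-fromGaps 1 1 ds) (trans (sum-ascend-+ 1 1 0 ds) (cong (_+ sum (ascend 1 0 ds)) (*-identityˡ (length ds))))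

-- The bit vector bₖ₋₁ ⋯ b₀ (head first) stands for the set {M + i ∣ bᵢ = true}, in decreasing order.
members : ℕ → ∀ {k} → Vec Bool k → List ℕ
members M []                   = []
members M {suc k} (true ∷ bs)  = M + k ∷ members M bs
members M         (false ∷ bs) = members M bs

members-< : ∀ M {k} (v : Vec Bool k) → Bounded (M + k) (members M v)
members-< M []                   = []
members-< M {suc k} (true ∷ bs)  = M+k<M+1+k ∷ All.map (λ p → <-trans p M+k<M+1+k) (members-< M bs)
  where M+k<M+1+k = +-monoʳ-< M (n<1+n k)
members-< M {suc k} (false ∷ bs) = All.map (λ p → <-trans p (+-monoʳ-< M (n<1+n k))) (members-< M bs)

members-≥ : ∀ M {k} (v : Vec Bool k) → All (M ≤_) (members M v)
members-≥ M []                   = []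
members-≥ M {suc k} (true ∷ bs)  = m≤m+n M k ∷ members-≥ M bs
members-≥ M         (false ∷ bs) = members-≥ M bs

members-descending : ∀ M {k} (v : Vec Bool k) → Descending 1 (members M v)
members-descending M []                   = []
members-descending M         (true ∷ bs)  = Descending-∷ (members-< M bs) (members-descending M bs)
members-descending M         (false ∷ bs) = members-descending M bs

toBits : (n : ℕ) → List ℕ → Vec Bool n
toBits zero    _        = []
toBits (suc n) []       = false ∷ toBits n []
toBits (suc n) (x ∷ xs) with x ≟ n
... | yes _ = true ∷ toBits n xs
... | no _  = false ∷ toBits n (x ∷ xs)

toBits-members : ∀ {n} (v : Vec Bool n) → toBits n (members 0 v) ≡ v
toBits-members [] = refl
toBits-members {suc n} (true ∷ bs) with n ≟ n
... | yes _ = cong (true ∷_) (toBits-members bs)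
... | no n≢n = contradiction refl n≢n
toBits-members {suc n} (false ∷ bs) = absent (members 0 bs) (members-< 0 bs) (toBits-members bs)
  where
  absent : ∀ xs → Bounded n xs → toBits n xs ≡ bs → toBits (suc n) xs ≡ false ∷ bs
  absent []       _       eq = cong (false ∷_) eq
  absent (x ∷ xs) (x<n ∷ _) eq with x ≟ n
  ... | yes refl = contradiction x<n (<-irrefl refl)
  ... | no _     = cong (false ∷_) eq

members-toBits : ∀ n {xs} → Descending 1 xs → Bounded n xs → members 0 (toBits n xs) ≡ xs
members-toBits zero    {[]}     _  _          = refl
members-toBits zero    {x ∷ xs} _  (() ∷ _)
members-toBits (suc n) {[]}     _  _          = members-toBits n [] []
members-toBits (suc n) {x ∷ xs} ps (x<1+n ∷ _) with x ≟ n
... | yes refl = cong (x ∷_) (members-toBits n (Descending-tail ps) (Descending-head ps))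
... | no x≢n   = members-toBits n ps (x<n ∷ All.map (λ y<x → <-trans y<x x<n) (Descending-head ps))
  where x<n = ≤∧≢⇒< (s≤s⁻¹ x<1+n) x≢n

members-++ : ∀ M {k N} (a : Vec Bool k) (b : Vec Bool N) →
             members M (a ++ᵛ b) ≡ members (M + N) a ++ members M b
members-++ M         []           b = refl
members-++ M {suc k} {N} (true ∷ a) b = cong₂ _∷_ (solve M k N) (members-++ M a b)
  where
  solve : ∀ M k N → M + (k + N) ≡ M + N + k
  solve = solve-∀
members-++ M         (false ∷ a)  b = members-++ M a b

sum-members-++ : ∀ {k N} (v : Vec Bool k) (l : Vec Bool N) →
                 sum (members 0 (v ++ᵛ l)) ≡ sum (members N v) + sum (members 0 l)
sum-members-++ v l = trans (cong sum (members-++ 0 v l)) (sum-++ (members _ v) (members 0 l))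

length-members-++ : ∀ {k N} (v : Vec Bool k) (l : Vec Bool N) →
                    length (members 0 (v ++ᵛ l)) ≡ length (members N v) + length (members 0 l)
length-members-++ v l = trans (cong length (members-++ 0 v l)) (length-++ (members _ v))

members-∷ʳ : ∀ M {k} (v : Vec Bool k) b → members M (v ∷ʳᵛ b) ≡ members (suc M) v ++ members M (b ∷ [])
members-∷ʳ M         []          b = refl
members-∷ʳ M {suc k} (true ∷ v)  b = cong₂ _∷_ (+-suc M k) (members-∷ʳ M v b)
members-∷ʳ M         (false ∷ v) b = members-∷ʳ M v b

members-replicate : ∀ M k → members M (replicate k false) ≡ []
members-replicate M zero    = refl
members-replicate M (suc k) = members-replicate M k

members≡[]⇒replicate : ∀ M {k} (v : Vec Bool k) → members M v ≡ [] → v ≡ replicate k false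
members≡[]⇒replicate M []          _  = refl
members≡[]⇒replicate M (false ∷ v) eq = cong (false ∷_) (members≡[]⇒replicate M v eq)

init-∷ʳ-last : ∀ {A : Set} {n} (v : Vec A (suc n)) → init v ∷ʳᵛ last v ≡ v
init-∷ʳ-last v = sym (proj₂ (proj₂ (initLast v)))

record Stat : Set where
  constructor stat
  field
    weight : ℕ
    aExp   : ℤ
    bExp   : ℕ

stat-cong : ∀ {w w' a a' b b'} → w ≡ w' → a ≡ a' → b ≡ b' → stat w a b ≡ stat w' a' b'
stat-cong refl refl refl = refl

_⊕_ : Stat → Stat → Stat
stat w a b ⊕ stat w' a' b' = stat (w + w') (a ℤ+ a') (b + b')

⊕-exchange : ∀ r s t → r ⊕ (s ⊕ t) ≡ s ⊕ (r ⊕ t)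
⊕-exchange (stat w₁ a₁ b₁) (stat w₂ a₂ b₂) (stat w₃ a₃ b₃) =
  stat-cong (exchange w₁ w₂ w₃) (ℤ-exchange a₁ a₂ a₃) (exchange b₁ b₂ b₃)
  where
  exchange : ∀ x y z → x + (y + z) ≡ y + (x + z)
  exchange = solve-∀
  ℤ-exchange : ∀ x y z → x ℤ+ (y ℤ+ z) ≡ y ℤ+ (x ℤ+ z)
  ℤ-exchange = ℤ-solve-∀

absorb : Stat → Stat
absorb (stat w a b) = stat (w + b) a 0

+a-+b≡+c-+d : ∀ a b c d → a + d ≡ c + b → + a - + b ≡ + c - + d
+a-+b≡+c-+d a b c d eq = begin
  + a - + b                   ≡⟨ ℤ-solve (+ a) (+ b) (+ d) ⟩
  + a ℤ+ + d - + b - + d     ≡⟨ cong (λ t → + t - + b - + d) eq ⟩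
  + c ℤ+ + b - + b - + d     ≡⟨ ℤ-solve' (+ c) (+ b) (+ d) ⟩
  + c - + d                   ∎
  where
  open ≡-Reasoning
  ℤ-solve : ∀ a b d → a - b ≡ a ℤ+ d - b - d
  ℤ-solve = ℤ-solve-∀
  ℤ-solve' : ∀ c b d → c ℤ+ b - b - d ≡ c - d
  ℤ-solve' = ℤ-solve-∀

+[m+n]-+m≡+n : ∀ m n → + (m + n) - + m ≡ + n
+[m+n]-+m≡+n m n = solve (+ m) (+ n)
  where
  solve : ∀ a b → a ℤ+ b - a ≡ b
  solve = ℤ-solve-∀

+m-+n≡+k⇒m≡n+k : ∀ {m n k} → + m - + n ≡ + k → m ≡ n + k
+m-+n≡+k⇒m≡n+k {m} {n} {k} eq = trans (ℤ.+-injective (trans (solve (+ m) (+ n)) (cong (_ℤ+ + n) eq))) (+-comm k n)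
  where
  solve : ∀ a b → a ≡ a - b ℤ+ b
  solve = ℤ-solve-∀

-- Configurations and the level shift

record BoundedPartition (n : ℕ) : Set where
  constructor boundedPartition
  field
    parts      : List ℕ
    descending : Descending 0 parts
    bounded    : Bounded n parts

boundedPartition-≡ : ∀ {n xs ys} {d : Descending 0 xs} {d' : Descending 0 ys}
                       {b : Bounded n xs} {b' : Bounded n ys} →
                     xs ≡ ys → boundedPartition xs d b ≡ boundedPartition ys d' b'
boundedPartition-≡ {d = d} {d'} {b} {b'} refl =
  cong₂ (boundedPartition _) (Descending-irrelevant d d') (All.irrelevant <-irrelevant b b')

castBound : ∀ {m n} → m ≡ n → BoundedPartition m → BoundedPartition n
castBound eq (boundedPartition μ d b) = boundedPartition μ d (subst (λ n → Bounded n μ) eq b)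

raise : ∀ {n} → BoundedPartition n → BoundedPartition (suc n)
raise (boundedPartition μ d b) = boundedPartition μ d (All.map m<n⇒m<1+n b)

addTop : ∀ {n} → BoundedPartition (suc n) → BoundedPartition (suc n)
addTop {n} (boundedPartition μ d b) = boundedPartition (n ∷ μ) (Descending-∷ (All.map s≤s⁻¹ b) d) (n<1+n n ∷ b)

-- A configuration of level M: a distinct partition γ by its gaps, a set S ⊆ [M, M + l(γ)) by its
-- bit vector, and a partition with parts below M + l(γ).
record Config (M : ℕ) : Set where
  constructor config
  field
    gaps      : List ℕ
    bits      : Vec Bool (length gaps)
    partition : BoundedPartition (M + length gaps)

configStat : ∀ {M} → Config M → Stat
configStat {M} (config g v (boundedPartition μ _ _)) =
  stat (sum (ascend 1 0 g) + sum (members M v) + sum μ)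
       (+ length (members M v) - + length g)
       (length g + length μ)

config-≡ : ∀ {M g v} {p q : BoundedPartition (M + length g)} →
           BoundedPartition.parts p ≡ BoundedPartition.parts q → config g v p ≡ config g v q
config-≡ eq = cong (config _ _) (boundedPartition-≡ eq)

-- The value M leaves the window [M, M + l(γ)) and M + l(γ) enters it. If M ∈ S it is traded for
-- M + l(γ), paid for by lowering every part of γ by one; if γ has the part 0, that part is removed
-- instead and μ gains the part M + l(γ) − 1.
shiftWith : ∀ {M} x gs → Vec Bool (length gs) → Bool → BoundedPartition (M + suc (length gs)) →
            Config (suc M)
shiftWith x       gs vs false p = config (x ∷ gs) (false ∷ vs) (raise p)
shiftWith (suc x) gs vs true  p = config (x ∷ gs) (true ∷ vs) (raise p)
shiftWith {M} zero gs vs true p = config gs vs (addTop (castBound (+-suc M (length gs)) p))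

shift : ∀ {M} → Config M → Config (suc M)
shift (config []       []  p) = config [] [] (raise p)
shift (config (x ∷ gs) v   p) = shiftWith x gs (init v) (last v) p

unshiftBits : ∀ {M} (g : List ℕ) → Vec Bool (length g) → BoundedPartition (M + length g) → Config M
unshiftBits []       []           p = config [] [] p
unshiftBits (x ∷ gs) (false ∷ vs) p = config (x ∷ gs) (vs ∷ʳᵛ false) p
unshiftBits (x ∷ gs) (true ∷ vs)  p = config (suc x ∷ gs) (vs ∷ʳᵛ true) p

unshift : ∀ {M} → Config (suc M) → Config M
unshift (config g v (boundedPartition [] d b)) = unshiftBits g v (boundedPartition [] d [])
unshift {M} (config g v (boundedPartition (h ∷ μ) d (h<1+n ∷ b))) with h ≟ M + length g
... | yes refl = config (0 ∷ g) (v ∷ʳᵛ true)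
                   (castBound (sym (+-suc M (length g)))
                     (boundedPartition μ (Descending-tail d) (All.map s≤s (Descending-head d))))
... | no h≢n   =
  unshiftBits g v (boundedPartition (h ∷ μ) d (h<n ∷ All.map (λ y≤h → ≤-<-trans y≤h h<n) (Descending-head d)))
  where h<n = ≤∧≢⇒< (s≤s⁻¹ h<1+n) h≢n

unshift-shiftWith : ∀ {M} x gs vs b (p : BoundedPartition (M + suc (length gs))) →
                    unshift (shiftWith x gs vs b p) ≡ config (x ∷ gs) (vs ∷ʳᵛ b) p
unshift-shiftWith x gs vs false (boundedPartition [] d b) = config-≡ refl
unshift-shiftWith {M} x gs vs false (boundedPartition (h ∷ μ) d (h<n ∷ b)) with h ≟ M + suc (length gs)
... | yes refl = contradiction h<n (<-irrefl refl)
... | no _     = config-≡ refl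
unshift-shiftWith (suc x) gs vs true (boundedPartition [] d b) = config-≡ refl
unshift-shiftWith {M} (suc x) gs vs true (boundedPartition (h ∷ μ) d (h<n ∷ b)) with h ≟ M + suc (length gs)
... | yes refl = contradiction h<n (<-irrefl refl)
... | no _     = config-≡ refl
unshift-shiftWith {M} zero gs vs true p with M + length gs ≟ M + length gs
... | yes refl = config-≡ refl
... | no n≢n   = contradiction refl n≢n

unshift-shift : ∀ {M} (o : Config M) → unshift (shift o) ≡ o
unshift-shift (config [] [] (boundedPartition [] d b)) = config-≡ refl
unshift-shift {M} (config [] [] (boundedPartition (h ∷ μ) d (h<n ∷ b))) with h ≟ M + 0
... | yes refl = contradiction h<n (<-irrefl refl)
... | no _     = config-≡ refl
unshift-shift (config (x ∷ gs) v p) =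
  trans (unshift-shiftWith x gs (init v) (last v) p)
        (cong (λ w → config (x ∷ gs) w p) (init-∷ʳ-last v))

shift-unshiftBits : ∀ {M} g v (p : BoundedPartition (M + length g)) →
                    shift (unshiftBits g v p) ≡ config g v (raise p)
shift-unshiftBits []       []           p = refl
shift-unshiftBits (x ∷ gs) (false ∷ vs) p rewrite init-∷ʳ false vs | last-∷ʳ false vs = refl
shift-unshiftBits (x ∷ gs) (true ∷ vs)  p rewrite init-∷ʳ true vs  | last-∷ʳ true vs  = refl

shift-unshift : ∀ {M} (o : Config (suc M)) → shift (unshift o) ≡ o
shift-unshift (config g v (boundedPartition [] d [])) = trans (shift-unshiftBits g v _) (config-≡ refl)
shift-unshift {M} (config g v (boundedPartition (h ∷ μ) d (h<n ∷ b))) with h ≟ M + length g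
... | yes refl rewrite init-∷ʳ true v | last-∷ʳ true v = config-≡ refl
... | no _     = trans (shift-unshiftBits g v _) (config-≡ refl)

shiftWith-stat : ∀ {M} x gs vs b (p : BoundedPartition (M + suc (length gs))) →
                 configStat (shiftWith x gs vs b p) ≡ configStat (config (x ∷ gs) (vs ∷ʳᵛ b) p)
shiftWith-stat {M} x gs vs b (boundedPartition μ _ _)
  rewrite members-∷ʳ M vs b
        | sum-++ (members (suc M) vs) (members M (b ∷ []))
        | length-++ (members (suc M) vs) {members M (b ∷ [])}
        = cases x b
  where
  S = sum (members (suc M) vs)
  c = length (members (suc M) vs)
  l = length gs
  cases : ∀ x b → configStat (shiftWith x gs vs b (boundedPartition μ _ _)) ≡
                  stat (sum (ascend 1 0 (x ∷ gs)) + (S + sum (members M (b ∷ []))) + sum μ)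
                       (+ (c + length (members M (b ∷ []))) - + suc l)
                       (suc l + length μ)
  cases x false =
    stat-cong (cong (λ t → sum (ascend 1 0 (x ∷ gs)) + t + sum μ) (sym (+-identityʳ S)))
              (cong (λ t → + t - + suc l) (sym (+-identityʳ c)))
              refl
  cases (suc x) true =
    stat-cong (trans (regroup (sum (ascend 1 0 (x ∷ gs))) M l S (sum μ))
                     (cong (λ t → t + (S + (M + 0 + 0)) + sum μ)
                           (sym (trans (cong sum (ascend-head-+ 1 1 0 x gs)) (sum-ascend-+ 1 1 0 (x ∷ gs))))))
              (cong (λ t → + t - + suc l) (sym (+-comm c 1)))
              refl
    where
    regroup : ∀ A M l S P → A + (suc M + l + S) + P ≡ 1 * suc l + A + (S + (M + 0 + 0)) + P
    regroup = solve-∀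
  cases zero true =
    stat-cong (trans (regroup (sum (ascend 1 0 gs)) M l S (sum μ))
                     (cong (λ t → t + (S + (M + 0 + 0)) + sum μ) (sym (sum-ascend-+ 1 1 0 gs))))
              (+a-+b≡+c-+d c l (c + 1) (suc l) (regroup′ c l))
              (+-suc l (length μ))
    where
    regroup : ∀ A M l S P → A + S + (M + l + P) ≡ 1 * l + A + (S + (M + 0 + 0)) + P
    regroup = solve-∀
    regroup′ : ∀ c l → c + suc l ≡ c + 1 + l
    regroup′ = solve-∀

shift-stat : ∀ {M} (o : Config M) → configStat (shift o) ≡ configStat o
shift-stat (config []       [] p) = refl
shift-stat (config (x ∷ gs) v  p) =
  trans (shiftWith-stat x gs (init v) (last v) p)
        (cong (λ w → configStat (config (x ∷ gs) w p)) (init-∷ʳ-last v))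

shift↔ : ∀ {M} → Config M ↔ Config (suc M)
shift↔ = mk↔ₛ′ shift unshift shift-unshift unshift-shift

shifts↔ : ∀ {M} j → Config M ↔ Config (j + M)
shifts↔ zero    = ↔-id _
shifts↔ (suc j) = shift↔ ↔-∘ shifts↔ j

shifts-stat : ∀ {M} j (o : Config M) → configStat (Inverse.to (shifts↔ j) o) ≡ configStat o
shifts-stat zero    o = refl
shifts-stat (suc j) o = trans (shift-stat (Inverse.to (shifts↔ j) o)) (shifts-stat j o)

-- A distinct partition, by its gaps, and a partition.
record Bipartition : Set where
  constructor bipartition
  field
    gaps       : List ℕ
    parts      : List ℕ
    descending : Descending 0 parts

bipartitionStat : Bipartition → Stat
bipartitionStat (bipartition g μ _) = stat (sum (ascend 1 0 g) + sum μ) (- + length g) (length g + length μ)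

bipartition-≡ : ∀ {g g' μ μ'} {d : Descending 0 μ} {d' : Descending 0 μ'} →
                g ≡ g' → μ ≡ μ' → bipartition g μ d ≡ bipartition g' μ' d'
bipartition-≡ {d = d} {d'} refl refl = cong (bipartition _ _) (Descending-irrelevant d d')

forgetBits : ∀ {L} → Config L → Bipartition
forgetBits (config g _ (boundedPartition μ d _)) = bipartition g μ d

withoutBits : ∀ {L} (y : Bipartition) → Bounded (L + length (Bipartition.gaps y)) (Bipartition.parts y) → Config L
withoutBits (bipartition g μ d) b = config g (replicate _ false) (boundedPartition μ d b)

members-empty-below-level : ∀ {L} (o : Config L) → Stat.weight (configStat o) < L →
                            members L (Config.bits o) ≡ []
members-empty-below-level {L} (config g v (boundedPartition μ _ _)) w<L
  with members L v | members-≥ L v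
... | []     | _          = refl
... | x ∷ xs | L≤x ∷ _    = contradiction w<L (≤⇒≯ (begin
  L                                          ≤⟨ L≤x ⟩
  x                                          ≤⟨ m≤m+n x (sum xs) ⟩
  x + sum xs                                 ≤⟨ m≤n+m _ (sum (ascend 1 0 g)) ⟩
  sum (ascend 1 0 g) + (x + sum xs)          ≤⟨ m≤m+n _ (sum μ) ⟩
  sum (ascend 1 0 g) + (x + sum xs) + sum μ  ∎))
  where open ≤-Reasoning

forgetBits-stat : ∀ {L} (o : Config L) → members L (Config.bits o) ≡ [] →
                  bipartitionStat (forgetBits o) ≡ configStat o
forgetBits-stat (config g v (boundedPartition μ _ _)) none rewrite none =
  stat-cong (cong (_+ sum μ) (sym (+-identityʳ (sum (ascend 1 0 g))))) (sym (ℤ.+-identityˡ _)) refl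

withoutBits-forgetBits : ∀ {L} (o : Config L) → members L (Config.bits o) ≡ [] → ∀ b →
                         withoutBits (forgetBits o) b ≡ o
withoutBits-forgetBits {L} (config g v (boundedPartition μ _ _)) none b
  rewrite members≡[]⇒replicate L v none = config-≡ refl

-- Φ shifts a configuration past its weight, where S has to be empty.
toBipartition : ∀ {N} → Config N → Bipartition
toBipartition o = forgetBits (Inverse.to (shifts↔ (suc (Stat.weight (configStat o)))) o)

fromBipartitionAt : ∀ {N} j (y : Bipartition) →
                    Bounded (j + N + length (Bipartition.gaps y)) (Bipartition.parts y) → Config N
fromBipartitionAt j y b = Inverse.from (shifts↔ j) (withoutBits y b)

fromBipartitionAt-cong : ∀ {N j j'} y b b' → j ≡ j' → fromBipartitionAt {N} j y b ≡ fromBipartitionAt j' y b'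
fromBipartitionAt-cong y b b' refl = cong (fromBipartitionAt _ y) (All.irrelevant <-irrelevant b b')

bipartition-bounded : ∀ N (y : Bipartition) →
                      Bounded (suc (Stat.weight (bipartitionStat y)) + N + length (Bipartition.gaps y))
                              (Bipartition.parts y)
bipartition-bounded N (bipartition g μ _) =
  All.map (λ x≤Σμ → s≤s (≤-trans x≤Σμ (≤-trans (m≤n+m (sum μ) (sum (ascend 1 0 g)))
                                                 (≤-trans (m≤m+n _ N) (m≤m+n _ (length g))))))
          (≤-sum μ)

fromBipartition : ∀ {N} → Bipartition → Config N
fromBipartition {N} y = fromBipartitionAt (suc (Stat.weight (bipartitionStat y))) y (bipartition-bounded N y)

shifted-members-empty : ∀ {N} (o : Config N) (let j = suc (Stat.weight (configStat o))) →
                        members (j + N) (Config.bits (Inverse.to (shifts↔ j) o)) ≡ []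
shifted-members-empty {N} o =
  members-empty-below-level (Inverse.to (shifts↔ j) o)
    (subst (λ s → Stat.weight s < j + N) (sym (shifts-stat j o)) (s≤s (m≤m+n _ N)))
  where j = suc (Stat.weight (configStat o))

toBipartition-stat : ∀ {N} (o : Config N) → bipartitionStat (toBipartition o) ≡ configStat o
toBipartition-stat o =
  trans (forgetBits-stat (Inverse.to (shifts↔ j) o) (shifted-members-empty o)) (shifts-stat j o)
  where j = suc (Stat.weight (configStat o))

fromBipartition-toBipartition : ∀ {N} (o : Config N) → fromBipartition (toBipartition o) ≡ o
fromBipartition-toBipartition {N} o = begin
  fromBipartition (forgetBits o')
    ≡⟨ fromBipartitionAt-cong (forgetBits o') _ bound (cong (suc ∘ Stat.weight) (toBipartition-stat o)) ⟩
  Inverse.from (shifts↔ j) (withoutBits (forgetBits o') bound)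
    ≡⟨ cong (Inverse.from (shifts↔ j)) (withoutBits-forgetBits o' (shifted-members-empty o) bound) ⟩
  Inverse.from (shifts↔ j) o'
    ≡⟨ Inverse.strictlyInverseʳ (shifts↔ j) o ⟩
  o ∎
  where
  open ≡-Reasoning
  j = suc (Stat.weight (configStat o))
  o' = Inverse.to (shifts↔ j) o
  bound = BoundedPartition.bounded (Config.partition o')

toBipartition-fromBipartition : ∀ {N} (y : Bipartition) → toBipartition {N} (fromBipartition y) ≡ y
toBipartition-fromBipartition {N} y = begin
  forgetBits (Inverse.to (shifts↔ (suc (Stat.weight (configStat o)))) o)
    ≡⟨ cong (λ k → forgetBits (Inverse.to (shifts↔ (suc k)) o)) weight-o ⟩
  forgetBits (Inverse.to (shifts↔ j) o)
    ≡⟨ cong forgetBits (Inverse.strictlyInverseˡ (shifts↔ j) X) ⟩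
  y ∎
  where
  open ≡-Reasoning
  j = suc (Stat.weight (bipartitionStat y))
  X = withoutBits y (bipartition-bounded N y)
  o = fromBipartition {N} y
  weight-o : Stat.weight (configStat o) ≡ Stat.weight (bipartitionStat y)
  weight-o = cong Stat.weight (begin
    configStat o                        ≡⟨ shifts-stat j o ⟨
    configStat (Inverse.to (shifts↔ j) o) ≡⟨ cong configStat (Inverse.strictlyInverseˡ (shifts↔ j) X) ⟩
    configStat X                        ≡⟨ forgetBits-stat X (members-replicate (j + N) (length (Bipartition.gaps y))) ⟨
    bipartitionStat y                   ∎)

fromBipartition-stat : ∀ {N} (y : Bipartition) → configStat (fromBipartition {N} y) ≡ bipartitionStat y
fromBipartition-stat {N} y =
  trans (sym (toBipartition-stat (fromBipartition {N} y))) (cong bipartitionStat (toBipartition-fromBipartition y))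

-- Sets with bounded partitions as pairs (C, D)

record GapPair (n : ℕ) : Set where
  constructor gapPair
  field
    cGaps   : List ℕ
    dGaps   : List ℕ
    lengths : length cGaps + length dGaps ≡ n

gapPair-≡ : ∀ {n cs cs' ds ds'} {e : length cs + length ds ≡ n} {e' : length cs' + length ds' ≡ n} →
            cs ≡ cs' → ds ≡ ds' → gapPair cs ds e ≡ gapPair cs' ds' e'
gapPair-≡ {e = e} {e'} refl refl = cong (gapPair _ _) (≡-irrelevant e e')

gapWeight : ∀ {n} → GapPair n → ℕ
gapWeight (gapPair cs ds _) = sum (ascend 1 0 cs) + sum (ascend 0 0 ds)

addToHead : ℕ → List ℕ → List ℕ
addToHead m []       = []
addToHead m (x ∷ xs) = m + x ∷ xs

length-addToHead : ∀ m xs → length (addToHead m xs) ≡ length xs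
length-addToHead m []       = refl
length-addToHead m (x ∷ xs) = refl

-- extend b m raises every part of C and D by m, or by m + 1 if b, and adds the new least part m,
-- to C if b and to D otherwise; retract tells the cases apart by comparing the least parts.
extend : ∀ {n} → Bool → ℕ → GapPair n → GapPair (suc n)
extend false m (gapPair cs ds e) =
  gapPair (addToHead m cs) (m ∷ ds)
          (trans (cong (_+ suc (length ds)) (length-addToHead m cs)) (trans (+-suc _ _) (cong suc e)))
extend true  m (gapPair cs ds e) =
  gapPair (m ∷ cs) (addToHead (suc m) ds)
          (cong suc (trans (cong (λ l → length cs + l) (length-addToHead (suc m) ds)) e))

retract : ∀ {n} → GapPair (suc n) → Bool × ℕ × GapPair n
retract (gapPair []       (y ∷ ds) e) = false , y , gapPair [] ds (suc-injective e)
retract (gapPair (x ∷ cs) []       e) = true  , x , gapPair cs [] (suc-injective e)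
retract (gapPair (x ∷ cs) (y ∷ ds) e) with y ≤? x
... | yes _ = false , y , gapPair (x ∸ y ∷ cs) ds (suc-injective (trans (sym (+-suc (suc (length cs)) (length ds))) e))
... | no _  = true  , x , gapPair cs (y ∸ suc x ∷ ds) (suc-injective e)

retract-extend : ∀ {n} b m (c : GapPair n) → retract (extend b m c) ≡ (b , m , c)
retract-extend false m (gapPair []       ds e) = cong (λ c → false , m , c) (gapPair-≡ refl refl)
retract-extend false m (gapPair (x ∷ cs) ds e) with m ≤? m + x
... | yes _   = cong (λ c → false , m , c) (gapPair-≡ (cong (_∷ cs) (m+n∸m≡n m x)) refl)
... | no m≰m+x = contradiction (m≤m+n m x) m≰m+x
retract-extend true m (gapPair cs []       e) = cong (λ c → true , m , c) (gapPair-≡ refl refl)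
retract-extend true m (gapPair cs (y ∷ ds) e) with suc m + y ≤? m
... | yes 1+m+y≤m = contradiction (≤-trans (s≤s (m≤m+n m y)) 1+m+y≤m) (<-irrefl refl)
... | no _        = cong (λ c → true , m , c) (gapPair-≡ refl (cong (_∷ ds) (m+n∸m≡n (suc m) y)))

extend-retract : ∀ {n} (c : GapPair (suc n)) → let (b , m , c') = retract c in extend b m c' ≡ c
extend-retract (gapPair []       (y ∷ ds) e) = gapPair-≡ refl refl
extend-retract (gapPair (x ∷ cs) []       e) = gapPair-≡ refl refl
extend-retract (gapPair (x ∷ cs) (y ∷ ds) e) with y ≤? x
... | yes y≤x = gapPair-≡ (cong (_∷ cs) (m+[n∸m]≡n y≤x)) refl
... | no y≰x  = gapPair-≡ refl (cong (_∷ ds) (m+[n∸m]≡n (≰⇒> y≰x)))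

sum-ascend-addToHead : ∀ δ s m ds → sum (ascend δ s (addToHead m ds)) ≡ m * length ds + sum (ascend δ s ds)
sum-ascend-addToHead δ s m []       = sym (trans (+-identityʳ (m * 0)) (*-zeroʳ m))
sum-ascend-addToHead δ s m (d ∷ ds) = trans (cong sum (ascend-head-+ δ m s d ds)) (sum-ascend-+ δ m s (d ∷ ds))

extend-weight : ∀ {n} b m (c : GapPair n) → gapWeight (extend b m c) ≡ (if b then n else 0) + m * suc n + gapWeight c
extend-weight false m (gapPair cs ds refl)
  rewrite sum-ascend-addToHead 1 0 m cs | sum-ascend 0 m ds =
    solve m (length cs) (length ds) (sum (ascend 1 0 cs)) (sum (ascend 0 0 ds))
  where
  solve : ∀ m c d C D → m * c + C + (m + (m * d + D)) ≡ 0 + m * suc (c + d) + (C + D)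
  solve = solve-∀
extend-weight true m (gapPair cs ds refl)
  rewrite sum-ascend 1 (suc m) cs | sum-ascend-addToHead 0 0 (suc m) ds =
    solve m (length cs) (length ds) (sum (ascend 1 0 cs)) (sum (ascend 0 0 ds))
  where
  solve : ∀ m c d C D → m + (suc m * c + C) + (suc m * d + D) ≡ c + d + m * suc (c + d) + (C + D)
  solve = solve-∀

extend-count : ∀ {n} b m (c : GapPair n) →
               length (GapPair.cGaps (extend b m c)) ≡ (if b then 1 else 0) + length (GapPair.cGaps c)
extend-count false m (gapPair cs ds e) = length-addToHead m cs
extend-count true  m (gapPair cs ds e) = refl

-- A partition with parts ≤ n is the multiplicity of n together with a partition with parts < n.
unpeel : ∀ {n} → ℕ → BoundedPartition n → BoundedPartition (suc n)
unpeel zero    p = raise p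
unpeel (suc m) p = addTop (unpeel m p)

peelParts : ∀ {n} xs → Descending 0 xs → Bounded (suc n) xs → ℕ × BoundedPartition n
peelParts []       _ _ = 0 , boundedPartition [] [] []
peelParts {n} (x ∷ xs) d (x<1+n ∷ b) with x ≟ n
... | yes refl = let (m , p) = peelParts xs (Descending-tail d) b in suc m , p
... | no x≢n   = 0 , boundedPartition (x ∷ xs) d (x<n ∷ All.map (λ y≤x → ≤-<-trans y≤x x<n) (Descending-head d))
  where x<n = ≤∧≢⇒< (s≤s⁻¹ x<1+n) x≢n

peel : ∀ {n} → BoundedPartition (suc n) → ℕ × BoundedPartition n
peel (boundedPartition xs d b) = peelParts xs d b

peelParts-irrelevant : ∀ {n} xs d d' (b b' : Bounded (suc n) xs) → peelParts xs d b ≡ peelParts xs d' b'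
peelParts-irrelevant xs d d' b b' = cong₂ (peelParts xs) (Descending-irrelevant d d') (All.irrelevant <-irrelevant b b')

peel-unpeel : ∀ {n} m (p : BoundedPartition n) → peel (unpeel m p) ≡ (m , p)
peel-unpeel {n} zero (boundedPartition [] d b) = cong (0 ,_) (boundedPartition-≡ refl)
peel-unpeel {n} zero (boundedPartition (x ∷ xs) d (x<n ∷ b)) with x ≟ n
... | yes refl = contradiction x<n (<-irrefl refl)
... | no _     = cong (0 ,_) (boundedPartition-≡ refl)
peel-unpeel {n} (suc m) p with n ≟ n
... | yes refl = cong (λ (m , p) → suc m , p) (trans (peelParts-irrelevant parts _ descending _ bounded) (peel-unpeel m p))
  where open BoundedPartition (unpeel m p)
... | no n≢n   = contradiction refl n≢n

unpeel-peelParts : ∀ {n} xs d (b : Bounded (suc n) xs) →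
                   let (m , p) = peelParts xs d b in BoundedPartition.parts (unpeel m p) ≡ xs
unpeel-peelParts []       d b = refl
unpeel-peelParts {n} (x ∷ xs) d (x<1+n ∷ b) with x ≟ n
... | yes refl = cong (x ∷_) (unpeel-peelParts xs (Descending-tail d) b)
... | no _     = refl

unpeel-peel : ∀ {n} (p : BoundedPartition (suc n)) → let (m , p') = peel p in unpeel m p' ≡ p
unpeel-peel (boundedPartition xs d b) = boundedPartition-≡ (unpeel-peelParts xs d b)

sum-map-suc-unpeel : ∀ {n} m (p : BoundedPartition n) →
                     sum (map suc (BoundedPartition.parts (unpeel m p)))
                     ≡ m * suc n + sum (map suc (BoundedPartition.parts p))
sum-map-suc-unpeel zero    p = refl
sum-map-suc-unpeel {n} (suc m) p =
  trans (cong (λ t → suc n + t) (sum-map-suc-unpeel m p)) (sym (+-assoc (suc n) (m * suc n) _))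

assemble : ∀ n → Vec Bool n → BoundedPartition n → GapPair n
assemble zero    []       _ = gapPair [] [] refl
assemble (suc n) (b ∷ bs) p = let (m , p') = peel p in extend b m (assemble n bs p')

disassemble : ∀ n → GapPair n → Vec Bool n × BoundedPartition n
disassemble zero    _ = [] , boundedPartition [] [] []
disassemble (suc n) c = let (b , m , c') = retract c ; (bs , p) = disassemble n c' in b ∷ bs , unpeel m p

disassemble-assemble : ∀ n bs p → disassemble n (assemble n bs p) ≡ (bs , p)
disassemble-assemble zero [] (boundedPartition [] d []) = cong ([] ,_) (boundedPartition-≡ refl)
disassemble-assemble (suc n) (b ∷ bs) p
  rewrite retract-extend b (proj₁ (peel p)) (assemble n bs (proj₂ (peel p)))
        | disassemble-assemble n bs (proj₂ (peel p)) = cong (b ∷ bs ,_) (unpeel-peel p)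

assemble-disassemble : ∀ n c → uncurry (assemble n) (disassemble n c) ≡ c
assemble-disassemble zero (gapPair [] [] e) = gapPair-≡ refl refl
assemble-disassemble (suc n) c
  rewrite peel-unpeel (proj₁ (proj₂ (retract c))) (proj₂ (disassemble n (proj₂ (proj₂ (retract c)))))
        | assemble-disassemble n (proj₂ (proj₂ (retract c))) = extend-retract c

assemble↔ : ∀ n → (Vec Bool n × BoundedPartition n) ↔ GapPair n
assemble↔ n = mk↔ₛ′ (uncurry (assemble n)) (disassemble n)
                    (assemble-disassemble n) (λ (bs , p) → disassemble-assemble n bs p)

sum-members-∷ : ∀ {n} b (bs : Vec Bool n) → sum (members 0 (b ∷ bs)) ≡ (if b then n else 0) + sum (members 0 bs)
sum-members-∷ true  bs = refl
sum-members-∷ false bs = refl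

length-members-∷ : ∀ {n} b (bs : Vec Bool n) →
                   length (members 0 (b ∷ bs)) ≡ (if b then 1 else 0) + length (members 0 bs)
length-members-∷ true  bs = refl
length-members-∷ false bs = refl

assemble-weight : ∀ n bs p → gapWeight (assemble n bs p) ≡ sum (members 0 bs) + sum (map suc (BoundedPartition.parts p))
assemble-weight zero    []       (boundedPartition [] _ []) = refl
assemble-weight (suc n) (b ∷ bs) p = begin
  gapWeight (extend b m (assemble n bs p'))
    ≡⟨ extend-weight b m (assemble n bs p') ⟩
  bit + m * suc n + gapWeight (assemble n bs p')
    ≡⟨ cong (λ w → bit + m * suc n + w) (assemble-weight n bs p') ⟩
  bit + m * suc n + (sum (members 0 bs) + sum (map suc (BoundedPartition.parts p')))
    ≡⟨ solve bit (m * suc n) (sum (members 0 bs)) (sum (map suc (BoundedPartition.parts p'))) ⟩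
  bit + sum (members 0 bs) + (m * suc n + sum (map suc (BoundedPartition.parts p')))
    ≡⟨ cong (λ w → bit + sum (members 0 bs) + w)
            (trans (sym (sum-map-suc-unpeel m p')) (cong (sum ∘ map suc ∘ BoundedPartition.parts) (unpeel-peel p))) ⟩
  bit + sum (members 0 bs) + sum (map suc (BoundedPartition.parts p))
    ≡⟨ cong (_+ sum (map suc (BoundedPartition.parts p))) (sum-members-∷ b bs) ⟨
  sum (members 0 (b ∷ bs)) + sum (map suc (BoundedPartition.parts p)) ∎
  where
  open ≡-Reasoning
  m = proj₁ (peel p)
  p' = proj₂ (peel p)
  bit = if b then n else 0
  solve : ∀ a b c d → a + b + (c + d) ≡ a + c + (b + d)
  solve = solve-∀

assemble-count : ∀ n bs p → length (GapPair.cGaps (assemble n bs p)) ≡ length (members 0 bs)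
assemble-count zero    []       _ = refl
assemble-count (suc n) (b ∷ bs) p =
  trans (extend-count b (proj₁ (peel p)) (assemble n bs (proj₂ (peel p))))
        (trans (cong (_+_ (if b then 1 else 0)) (assemble-count n bs (proj₂ (peel p))))
               (sym (length-members-∷ b bs)))

Pieces : ℕ → Set
Pieces N = Bipartition × Config N × Vec Bool N

bitsStat : ∀ {N} → Vec Bool N → Stat
bitsStat l = stat (sum (members 0 l)) (ℓ (members 0 l)) 0

-- absorb accounts for pieces stored with every part lowered by one: α and β on the 𝒜 side, E and
-- the parts of D coming from μ on the ℬ side.
statᴬ statᴮ : ∀ {N} → Pieces N → Stat
statᴬ (y , o , l) = absorb (bipartitionStat y) ⊕ (configStat o ⊕ bitsStat l)
statᴮ (y , o , l) = bipartitionStat y ⊕ (absorb (configStat o) ⊕ bitsStat l)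

swap : ∀ {N} → Pieces N → Pieces N
swap (y , o , l) = toBipartition o , fromBipartition y , l

swap-involutive : ∀ {N} (x : Pieces N) → swap (swap x) ≡ x
swap-involutive (y , o , l) =
  cong₂ _,_ (toBipartition-fromBipartition y) (cong (_, l) (fromBipartition-toBipartition o))

swap↔ : ∀ {N} → Pieces N ↔ Pieces N
swap↔ = mk↔ₛ′ swap swap swap-involutive swap-involutive

swap-stat : ∀ {N} (x : Pieces N) → statᴮ (swap x) ≡ statᴬ x
swap-stat (y , o , l) = begin
  bipartitionStat (toBipartition o) ⊕ (absorb (configStat (fromBipartition y)) ⊕ bitsStat l)
    ≡⟨ cong₂ (λ s t → s ⊕ (absorb t ⊕ bitsStat l)) (toBipartition-stat o) (fromBipartition-stat y) ⟩
  configStat o ⊕ (absorb (bipartitionStat y) ⊕ bitsStat l)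
    ≡⟨ ⊕-exchange (configStat o) (absorb (bipartitionStat y)) (bitsStat l) ⟩
  absorb (bipartitionStat y) ⊕ (configStat o ⊕ bitsStat l) ∎
  where open ≡-Reasoning

-- A distinct partition γ by its gaps, a set ⊆ [0, l(γ) + N) and a partition with parts below
-- l(γ) + N; window↔ merges the set S of a configuration with a set ⊆ [0, N).
Window : ℕ → Set
Window N = Σ (List ℕ) λ g → Vec Bool (length g + N) × BoundedPartition (length g + N)

window-≡ : ∀ {N g g'} {bs : Vec Bool (length g + N)} {bs' : Vec Bool (length g' + N)}
             {p : BoundedPartition (length g + N)} {p' : BoundedPartition (length g' + N)} →
           g ≡ g' → members 0 bs ≡ members 0 bs' → BoundedPartition.parts p ≡ BoundedPartition.parts p' →
           _≡_ {A = Window N} (g , bs , p) (g' , bs' , p')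
window-≡ {g = g} {bs = bs} {bs'} refl same-members same-parts =
  cong₂ (λ bs p → g , bs , p)
        (trans (sym (toBits-members bs)) (trans (cong (toBits _) same-members) (toBits-members bs')))
        (boundedPartition-≡ same-parts)

toWindow : ∀ {N} → Config N × Vec Bool N → Window N
toWindow {N} (config g v p , l) = g , v ++ᵛ l , castBound (+-comm N (length g)) p

fromWindow : ∀ {N} → Window N → Config N × Vec Bool N
fromWindow {N} (g , bs , p) = config g (take (length g) bs) (castBound (+-comm (length g) N) p) , drop (length g) bs

window↔ : ∀ {N} → (Config N × Vec Bool N) ↔ Window N
window↔ {N} = mk↔ₛ′ toWindow fromWindow to-from from-to
  where
  to-from : ∀ w → toWindow (fromWindow w) ≡ w
  to-from (g , bs , p) = window-≡ refl (cong (members 0) (take++drop≡id (length g) bs)) refl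
  from-to : ∀ x → fromWindow (toWindow x) ≡ x
  from-to (config g v p , l) =
    cong₂ _,_ (cong₂ (config g) (++-injectiveˡ _ v (take++drop≡id (length g) (v ++ᵛ l))) (boundedPartition-≡ refl))
              (++-injectiveʳ _ v (take++drop≡id (length g) (v ++ᵛ l)))

open Decidable⇒UIP ℤ._≟_ using () renaming (≡-irrelevant to ℤ-≡-irrelevant)

SetA-≡ : ∀ {N} {a a' : SetA N} → SetA.n a ≡ SetA.n a' → SetA.α a ≡ SetA.α a' → SetA.β a ≡ SetA.β a' →
         SetA.γ a ≡ SetA.γ a' → SetA.λ' a ≡ SetA.λ' a' → SetA.μ a ≡ SetA.μ a' → a ≡ a'
SetA-≡ {a = mkA _ _ _ _ _ _ p₁ p₂ p₃ p₄ p₅ p₆ p₇ p₈ p₉ p₁₀} {mkA _ _ _ _ _ _ q₁ q₂ q₃ q₄ q₅ q₆ q₇ q₈ q₉ q₁₀}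
       refl refl refl refl refl refl
  rewrite StrictDecreasing-irrelevant p₁ q₁ | All.irrelevant <-irrelevant p₂ q₂
        | Decreasing-irrelevant p₃ q₃ | All.irrelevant <-irrelevant p₄ q₄
        | StrictDecreasing-irrelevant p₅ q₅ | StrictDecreasing-irrelevant p₆ q₆
        | All.irrelevant <-irrelevant p₇ q₇ | Decreasing-irrelevant p₈ q₈
        | All.irrelevant <-irrelevant p₉ q₉ | ℤ-≡-irrelevant p₁₀ q₁₀ = refl

map-suc-pred : ∀ xs → Positive xs → map suc (map pred xs) ≡ xs
map-suc-pred xs pos = trans (sym (map-∘ xs)) (map-id-local (All.map (λ { {suc _} _ → refl }) pos))

map-pred-suc : ∀ xs → map pred (map suc xs) ≡ xs
map-pred-suc xs = trans (sym (map-∘ xs)) (map-id xs)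

-- α by its gaps counted from 1, β with every part lowered by one, γ by its gaps and λ as a bit vector.
decodeA : ∀ {N} → Bipartition × Window N → SetA N
decodeA {N} (bipartition gα β' dβ , g , bs , boundedPartition μ dμ bμ) =
  mkA (length g + N) (fromGaps 1 1 gα) (map suc β') (fromGaps 1 0 g) (members 0 bs) μ
      (Descending⇒StrictDecreasing (fromGaps-descending 1 1 gα)) (fromGaps-≥ 1 1 gα)
      (Descending⇒Decreasing (Descending-map s≤s dβ)) (All.map⁺ (All.universal (λ _ → s≤s z≤n) β'))
      (Descending⇒StrictDecreasing (fromGaps-descending 1 0 g))
      (Descending⇒StrictDecreasing (members-descending 0 bs)) (members-< 0 bs)
      (Descending⇒Decreasing dμ) bμ
      (trans (cong (λ k → + (length g + N) - + k) (length-fromGaps 1 0 g)) (+[m+n]-+m≡+n (length g) N))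

SetA-n≡ : ∀ {N} (a : SetA N) → SetA.n a ≡ length (toGaps 1 0 (SetA.γ a)) + N
SetA-n≡ {N} a = trans (+m-+n≡+k⇒m≡n+k (SetA.cond a)) (cong (_+ N) (sym (length-toGaps 1 0 (SetA.γ a))))

encodeA : ∀ {N} → SetA N → Bipartition × Window N
encodeA {N} a@(mkA n α β γ λ' μ _ _ βd _ _ _ _ μd μb c) =
  bipartition (toGaps 1 1 α) (map pred β) (Descending-map pred-mono-≤ (Decreasing⇒Descending βd)) ,
  g , toBits (length g + N) λ' ,
  boundedPartition μ (Decreasing⇒Descending μd) (subst (λ k → Bounded k μ) (SetA-n≡ a) μb)
  where g = toGaps 1 0 γ

decodeA-encodeA : ∀ {N} (a : SetA N) → decodeA (encodeA a) ≡ a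
decodeA-encodeA {N} a@(mkA n α β γ λ' μ αd αp βd βp γd λd λb μd μb c) =
  SetA-≡ (sym (SetA-n≡ a))
         (fromGaps-toGaps (StrictDecreasing⇒Descending αd) αp)
         (map-suc-pred β βp)
         (fromGaps-toGaps (StrictDecreasing⇒Descending γd) (All.universal (λ _ → z≤n) γ))
         (members-toBits _ (StrictDecreasing⇒Descending λd) (subst (λ k → Bounded k λ') (SetA-n≡ a) λb))
         refl

encodeA-decodeA : ∀ {N} (x : Bipartition × Window N) → encodeA (decodeA x) ≡ x
encodeA-decodeA {N} (bipartition gα β' dβ , g , bs , boundedPartition μ dμ bμ) =
  cong₂ _,_ (bipartition-≡ (toGaps-fromGaps 1 1 gα) (map-pred-suc β'))
            (window-≡ (toGaps-fromGaps 1 0 g)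
                      (members-toBits _ (members-descending 0 bs)
                        (subst (λ h → Bounded (length h + N) (members 0 bs))
                               (sym (toGaps-fromGaps 1 0 g)) (members-< 0 bs)))
                      refl)

decodeA↔ : ∀ {N} → (Bipartition × Window N) ↔ SetA N
decodeA↔ = mk↔ₛ′ decodeA encodeA decodeA-encodeA encodeA-decodeA

pieces↔A : ∀ {N} → Pieces N ↔ SetA N
pieces↔A = decodeA↔ ↔-∘ second↔ window↔

statA : ∀ {N} → SetA N → Stat
statA a = stat (weightA a) (aExpA a) (bExpA a)

pieces↔A-stat : ∀ {N} (x : Pieces N) → statA (Inverse.to pieces↔A x) ≡ statᴬ x
pieces↔A-stat {N} (bipartition gα β' _ , config g v (boundedPartition μ _ _) , l) =
  stat-cong weight aExp bExp
  where
  weight : sum (fromGaps 1 1 gα) + sum (map suc β') + sum (fromGaps 1 0 g) + sum (members 0 (v ++ᵛ l)) + sum μ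
         ≡ sum (ascend 1 0 gα) + sum β' + (length gα + length β')
           + (sum (ascend 1 0 g) + sum (members N v) + sum μ + sum (members 0 l))
  weight rewrite sum-fromGaps-1-1 gα | sum-map-suc β' | sum-fromGaps 1 0 g | sum-members-++ v l =
    solve (length gα) (sum (ascend 1 0 gα)) (length β') (sum β') (sum (ascend 1 0 g))
          (sum (members N v)) (sum (members 0 l)) (sum μ)
    where
    solve : ∀ la A lb B G V L M → la + A + (lb + B) + G + (V + L) + M ≡ A + B + (la + lb) + (G + V + M + L)
    solve = solve-∀
  aExp : ℓ (members 0 (v ++ᵛ l)) - ℓ (fromGaps 1 1 gα) - ℓ (fromGaps 1 0 g)
       ≡ - ℓ gα ℤ+ (ℓ (members N v) - ℓ g ℤ+ ℓ (members 0 l))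
  aExp rewrite length-members-++ v l | length-fromGaps 1 1 gα | length-fromGaps 1 0 g =
    solve (ℓ (members N v)) (ℓ (members 0 l)) (ℓ gα) (ℓ g)
    where
    solve : ∀ V L a g → V ℤ+ L - a - g ≡ - a ℤ+ (V - g ℤ+ L)
    solve = ℤ-solve-∀
  bExp : length (fromGaps 1 0 g) + length μ ≡ 0 + (length g + length μ + 0)
  bExp rewrite length-fromGaps 1 0 g = sym (+-identityʳ _)

GapCode : ℕ → Set
GapCode N = Bipartition × Σ (List ℕ) λ g → GapPair (length g + N)

Σ-gapPair-≡ : ∀ {N g g' cs cs' ds ds'}
                {e : length cs + length ds ≡ length g + N} {e' : length cs' + length ds' ≡ length g' + N} →
              g ≡ g' → cs ≡ cs' → ds ≡ ds' →
              _≡_ {A = Σ (List ℕ) λ g → GapPair (length g + N)} (g , gapPair cs ds e) (g' , gapPair cs' ds' e')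
Σ-gapPair-≡ {g = g} refl same-cs same-ds = cong (g ,_) (gapPair-≡ same-cs same-ds)

SetB-≡ : ∀ {N} {b b' : SetB N} → SetB.A b ≡ SetB.A b' → SetB.B b ≡ SetB.B b' → SetB.C b ≡ SetB.C b' →
         SetB.D b ≡ SetB.D b' → SetB.E b ≡ SetB.E b' → b ≡ b'
SetB-≡ {b = mkB _ _ _ _ _ p₁ p₂ p₃ p₄ p₅ p₆ p₇} {mkB _ _ _ _ _ q₁ q₂ q₃ q₄ q₅ q₆ q₇} refl refl refl refl refl
  rewrite StrictDecreasing-irrelevant p₁ q₁ | Decreasing-irrelevant p₂ q₂
        | StrictDecreasing-irrelevant p₃ q₃ | Decreasing-irrelevant p₄ q₄
        | StrictDecreasing-irrelevant p₅ q₅ | All.irrelevant <-irrelevant p₆ q₆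
        | ℤ-≡-irrelevant p₇ q₇ = refl

-- A, C and D by their gaps, E by its gaps counted from 1.
decodeB : ∀ {N} → GapCode N → SetB N
decodeB {N} (bipartition gA B dB , gE , gapPair gC gD e) =
  mkB (fromGaps 1 0 gA) B (fromGaps 1 0 gC) (fromGaps 0 0 gD) (fromGaps 1 1 gE)
      (Descending⇒StrictDecreasing (fromGaps-descending 1 0 gA)) (Descending⇒Decreasing dB)
      (Descending⇒StrictDecreasing (fromGaps-descending 1 0 gC)) (Descending⇒Decreasing (fromGaps-descending 0 0 gD))
      (Descending⇒StrictDecreasing (fromGaps-descending 1 1 gE)) (fromGaps-≥ 1 1 gE)
      cond
  where
  cond : + length (fromGaps 1 0 gC) ℤ+ + length (fromGaps 0 0 gD) - + length (fromGaps 1 1 gE) ≡ + N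
  cond rewrite length-fromGaps 1 0 gC | length-fromGaps 0 0 gD | length-fromGaps 1 1 gE =
    trans (cong (λ k → + k - + length gE) e) (+[m+n]-+m≡+n (length gE) N)

encodeB : ∀ {N} → SetB N → GapCode N
encodeB {N} (mkB A B C D E _ Bd _ _ _ _ c) =
  bipartition (toGaps 1 0 A) B (Decreasing⇒Descending Bd) , toGaps 1 1 E , gapPair (toGaps 1 0 C) (toGaps 0 0 D) lengths
  where
  lengths : length (toGaps 1 0 C) + length (toGaps 0 0 D) ≡ length (toGaps 1 1 E) + N
  lengths rewrite length-toGaps 1 0 C | length-toGaps 0 0 D | length-toGaps 1 1 E = +m-+n≡+k⇒m≡n+k c

decodeB-encodeB : ∀ {N} (b : SetB N) → decodeB (encodeB b) ≡ b
decodeB-encodeB (mkB A B C D E Ad Bd Cd Dd Ed Ep c) =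
  SetB-≡ (fromGaps-toGaps (StrictDecreasing⇒Descending Ad) (All.universal (λ _ → z≤n) A))
         refl
         (fromGaps-toGaps (StrictDecreasing⇒Descending Cd) (All.universal (λ _ → z≤n) C))
         (fromGaps-toGaps (Decreasing⇒Descending Dd) (All.universal (λ _ → z≤n) D))
         (fromGaps-toGaps (StrictDecreasing⇒Descending Ed) Ep)

encodeB-decodeB : ∀ {N} (x : GapCode N) → encodeB (decodeB x) ≡ x
encodeB-decodeB (bipartition gA B dB , gE , gapPair gC gD e) =
  cong₂ _,_ (bipartition-≡ (toGaps-fromGaps 1 0 gA) refl)
            (Σ-gapPair-≡ (toGaps-fromGaps 1 1 gE) (toGaps-fromGaps 1 0 gC) (toGaps-fromGaps 0 0 gD))

decodeB↔ : ∀ {N} → GapCode N ↔ SetB N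
decodeB↔ = mk↔ₛ′ decodeB encodeB decodeB-encodeB encodeB-decodeB

pieces↔B : ∀ {N} → Pieces N ↔ SetB N
pieces↔B {N} = decodeB↔ ↔-∘ (second↔ (Σ-second↔ (λ g → assemble↔ (length g + N))) ↔-∘ second↔ window↔)

statB : ∀ {N} → SetB N → Stat
statB b = stat (weightB b) (aExpB b) (bExpB b)

pieces↔B-stat : ∀ {N} (x : Pieces N) → statB (Inverse.to pieces↔B x) ≡ statᴮ x
pieces↔B-stat {N} (bipartition gA B _ , config g v p@(boundedPartition μ _ _) , l) =
  stat-cong weight aExp bExp
  where
  c = assemble (length g + N) (v ++ᵛ l) (castBound (+-comm N (length g)) p)
  cs = GapPair.cGaps c
  ds = GapPair.dGaps c
  gapWeight-c : sum (ascend 1 0 cs) + sum (ascend 0 0 ds)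
              ≡ sum (members N v) + sum (members 0 l) + (length μ + sum μ)
  gapWeight-c rewrite sym (sum-members-++ v l) | sym (sum-map-suc μ) = assemble-weight (length g + N) (v ++ᵛ l) _
  weight : sum (fromGaps 1 0 gA) + sum B + sum (fromGaps 1 0 cs) + sum (fromGaps 0 0 ds) + sum (fromGaps 1 1 g)
         ≡ sum (ascend 1 0 gA) + sum B
           + (sum (ascend 1 0 g) + sum (members N v) + sum μ + (length g + length μ) + sum (members 0 l))
  weight rewrite sum-fromGaps 1 0 gA | sum-fromGaps 1 0 cs | sum-fromGaps 0 0 ds | sum-fromGaps-1-1 g =
    trans (regroup (sum (ascend 1 0 gA)) (sum B) (sum (ascend 1 0 cs)) (sum (ascend 0 0 ds))
                   (length g) (sum (ascend 1 0 g)))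
          (trans (cong (λ w → sum (ascend 1 0 gA) + sum B + w + (length g + sum (ascend 1 0 g))) gapWeight-c)
                 (regroup′ (sum (ascend 1 0 gA)) (sum B) (sum (members N v)) (sum (members 0 l)) (length μ) (sum μ)
                           (length g) (sum (ascend 1 0 g))))
    where
    regroup : ∀ a b c d l g → a + b + c + d + (l + g) ≡ a + b + (c + d) + (l + g)
    regroup = solve-∀
    regroup′ : ∀ a b V L lm M l G → a + b + (V + L + (lm + M)) + (l + G) ≡ a + b + (G + V + M + (l + lm) + L)
    regroup′ = solve-∀
  aExp : ℓ (fromGaps 1 0 cs) - ℓ (fromGaps 1 0 gA) - ℓ (fromGaps 1 1 g)
       ≡ - ℓ gA ℤ+ (ℓ (members N v) - ℓ g ℤ+ ℓ (members 0 l))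
  aExp rewrite length-fromGaps 1 0 cs | assemble-count (length g + N) (v ++ᵛ l) (castBound (+-comm N (length g)) p)
             | length-members-++ v l | length-fromGaps 1 0 gA | length-fromGaps 1 1 g =
    solve (ℓ (members N v)) (ℓ (members 0 l)) (ℓ gA) (ℓ g)
    where
    solve : ∀ V L a g → V ℤ+ L - a - g ≡ - a ℤ+ (V - g ℤ+ L)
    solve = ℤ-solve-∀
  bExp : length (fromGaps 1 0 gA) + length B ≡ length gA + length B + 0
  bExp rewrite length-fromGaps 1 0 gA = sym (+-identityʳ _)

theorem4p1 : (N : ℕ) → Σ (SetA N ↔ SetB N) (λ f → (a : SetA N) → (weightA a ≡ weightB (Inverse.to f a)) × (aExpA a ≡ aExpB (Inverse.to f a)) × (bExpA a ≡ bExpB (Inverse.to f a)))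
theorem4p1 N = f , λ a → let eq = preserved a in
                 cong Stat.weight eq , cong Stat.aExp eq , cong Stat.bExp eq
  where
  f : SetA N ↔ SetB N
  f = pieces↔B ↔-∘ (swap↔ ↔-∘ ↔-sym pieces↔A)
  preserved : ∀ a → statA a ≡ statB (Inverse.to f a)
  preserved a = begin
    statA a                               ≡⟨ cong statA (Inverse.strictlyInverseˡ pieces↔A a) ⟨
    statA (Inverse.to pieces↔A x)         ≡⟨ pieces↔A-stat x ⟩
    statᴬ x                               ≡⟨ swap-stat x ⟨
    statᴮ (swap x)                        ≡⟨ pieces↔B-stat (swap x) ⟨
    statB (Inverse.to pieces↔B (swap x))  ∎
    where
    open ≡-Reasoning
    x = Inverse.from pieces↔A a
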